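{- Let $k$ be a positive integer and let $G_k$ be a graph that has no packing $(1^2,2^k)$-coloring but every proper subgraph of which has a packing $(1^2,2^k)$-coloring. Then there is no vertex $u$ of $G_k$ of degree $d\ge 1$ with neighbors $v_1,\dots,v_d$ such that, for every $i$, $v_i$ has degree $2$ and the neighbor $v_i'$ of $v_i$ other than $u$ also has degree $2$ (that is, $u$ is adjacent only to $2$-threads $v_1v_1',\dots,v_dv_d'$).
   Context: All graphs are finite and simple. A set of vertices is $i$-independent if any two distinct vertices in it are at distance at least $i+1$. A packing $(1^{\ell},2^{k})$-coloring of $G$ is a partition of $V(G)$ into $\ell$ independent sets and $k$ $2$-independent sets (some parts may be empty). A $2$-thread is an edge both of whose endpoints have degree $2$. -}

module Defs where

open import Data.Nat using (ℕ; suc)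
open import Data.Fin using (Fin)
open import Data.Bool using (Bool; true; false)
open import Data.Sum using (_⊎_; inj₁; inj₂)
open import Data.Product using (Σ; ∃; ∃-syntax; _×_; _,_)
open import Data.List using (List; length; filter)
open import Data.List using () renaming (allFin to allFin)
open import Relation.Nullary using (¬_)
open import Relation.Binary.PropositionalEquality using (_≡_; _≢_)
open import Data.Bool.Properties using (T?)
open import Data.Vec.Functional using () 

record Graph (n : ℕ) : Set where
  field
    adj   : Fin n → Fin n → Bool
    sym   : ∀ u v → adj u v ≡ adj v u
    irrefl : ∀ u → adj u u ≡ false
open Graph public

degree : ∀ {n} → Graph n → Fin n → ℕ
degree {n} G u = length (filter (λ v → T? (adj G u v)) (allFin n))

record Subgraph {n : ℕ} (G : Graph n) : Set where
  field
    keep     : Fin n → Bool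
    edge     : Fin n → Fin n → Bool
    edge-sym : ∀ u v → edge u v ≡ edge v u
    edge⊆    : ∀ u v → edge u v ≡ true → adj G u v ≡ true
    edge-keep : ∀ u v → edge u v ≡ true → keep u ≡ true
open Subgraph public

Proper : ∀ {n} {G : Graph n} → Subgraph G → Set
Proper {n} {G} H =
  (∃[ u ] keep H u ≡ false) ⊎ (∃[ u ] ∃[ v ] (adj G u v ≡ true × edge H u v ≡ false))

whole : ∀ {n} (G : Graph n) → Subgraph G
whole G = record
  { keep = λ _ → true ; edge = adj G ; edge-sym = sym G
  ; edge⊆ = λ _ _ p → p ; edge-keep = λ _ _ _ → _≡_.refl }

-- Colours inj₁ i (i < ℓ) form independent sets (distance ≥ 2);
-- colours inj₂ j (j < k) form 2-independent sets (distance ≥ 3, i.e. no edge and no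
-- common neighbour).
PackingColoring : ∀ {n} {G : Graph n} → ℕ → ℕ → Subgraph G → Set
PackingColoring {n} ℓ k H =
  Σ (Fin n → Fin ℓ ⊎ Fin k) λ c →
    (∀ u v → keep H u ≡ true → keep H v ≡ true → u ≢ v →
       ∀ i → c u ≡ inj₁ i → c v ≡ inj₁ i → edge H u v ≡ false)
    × (∀ u v → keep H u ≡ true → keep H v ≡ true → u ≢ v →
       ∀ j → c u ≡ inj₂ j → c v ≡ inj₂ j →
         (edge H u v ≡ false) × (∀ w → ¬ (edge H u w ≡ true × edge H w v ≡ true)))

Colorable12 : ∀ {n} → ℕ → Graph n → Set
Colorable12 k G = PackingColoring 2 k (whole G)

Critical12 : ∀ {n} → ℕ → Graph n → Set
Critical12 k G = ¬ Colorable12 k G × (∀ (H : Subgraph G) → Proper H → PackingColoring 2 k H)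

AdjOnlyTo2Threads : ∀ {n} → Graph n → Fin n → Set
AdjOnlyTo2Threads G u =
  (1 Data.Nat.≤ degree G u)
  × (∀ v → adj G u v ≡ true →
       degree G v ≡ 2 × (∀ w → adj G v w ≡ true → w ≢ u → degree G w ≡ 2))

-- Colour G − u by criticality and extend the colouring to u with the 2-colour X := inj₂ 0.
-- Every neighbour v of u is forced to a 1-colour: v has exactly one neighbour x besides u,
-- so a 1-colour different from that of x always exists (when x is also adjacent to u, the
-- index order of v and x decides which of the two gets which 1-colour).  A vertex w at
-- distance two from u that was coloured X has degree 2, and its neighbour outside N(u), if
-- any, was not coloured X; so w can be moved to a 1-colour avoiding that neighbour.  After
-- this, X is 2-independent again, and all other colour classes only lost vertices.
module Submission where

open import Defs hiding (sym)
open import Data.Nat using (ℕ; _≤_; suc; s≤s)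
open import Data.Nat.Properties using (m≤n⇒m≤1+n)
open import Data.Fin using (Fin; _<?_) renaming (zero to fzero; suc to fsuc)
open import Data.Fin.Properties using (any?; <-asym; ≤-total; ≤∧≢⇒<) renaming (_≟_ to _≟ᶠ_)
open import Data.Bool using (Bool; true; false; not; _∧_)
open import Data.Bool.Properties using (T?; T-≡; ∧-comm; ∧-conicalˡ; ∧-conicalʳ) renaming (_≟_ to _≟ᵇ_)
open import Data.Unit using (tt)
open import Data.Empty using (⊥)
open import Data.Sum using (_⊎_; inj₁; inj₂)
open import Data.Sum.Properties using (≡-dec)
open import Data.Product using (Σ; ∃; _×_; _,_; proj₁; proj₂)
open import Data.List using (List; length; filter; allFin)
open import Data.List.Membership.Propositional using (_∈_)
open import Data.List.Membership.Propositional.Properties using (∈-length; ∈-filter⁺; ∈-allFin)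
open import Data.List.Relation.Unary.Any using (here; there)
open import Function using (_∘_; case_of_)
open import Function.Bundles using (Equivalence)
open import Relation.Nullary using (¬_; Dec; yes; no; ¬?; contradiction)
open import Relation.Nullary.Decidable using (does; dec-true; dec-false; _×-dec_)
open import Relation.Unary using (Decidable; U)
open import Relation.Binary.PropositionalEquality
  using (_≡_; _≢_; refl; sym; trans; cong; cong₂; subst; ≢-sym)

2≤length : ∀ {A : Set} {a b} {xs : List A} → a ∈ xs → b ∈ xs → a ≢ b → 2 ≤ length xs
2≤length (here refl) (here refl) a≢b = contradiction refl a≢b
2≤length (here refl) (there b∈) _   = s≤s (∈-length b∈)
2≤length (there a∈) (here refl) _   = s≤s (∈-length a∈)
2≤length (there a∈) (there b∈) a≢b = m≤n⇒m≤1+n (2≤length a∈ b∈ a≢b)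

3≤length : ∀ {A : Set} {a b c} {xs : List A} → a ∈ xs → b ∈ xs → c ∈ xs →
           a ≢ b → a ≢ c → b ≢ c → 3 ≤ length xs
3≤length (here refl) (here refl) _           a≢b _   _   = contradiction refl a≢b
3≤length (here refl) (there _)   (here refl) _   a≢c _   = contradiction refl a≢c
3≤length (there _)   (here refl) (here refl) _   _   b≢c = contradiction refl b≢c
3≤length (here refl) (there b∈)  (there c∈)  _   _   b≢c = s≤s (2≤length b∈ c∈ b≢c)
3≤length (there a∈)  (here refl) (there c∈)  _   a≢c _   = s≤s (2≤length a∈ c∈ a≢c)
3≤length (there a∈)  (there b∈)  (here refl) a≢b _   _   = s≤s (2≤length a∈ b∈ a≢b)
3≤length (there a∈)  (there b∈)  (there c∈)  a≢b a≢c b≢c =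
  m≤n⇒m≤1+n (3≤length a∈ b∈ c∈ a≢b a≢c b≢c)

separates : ∀ {A : Set} (f : A → Bool) {x y} → f x ≡ true → f y ≡ false → x ≢ y
separates f fx fy refl with () ← trans (sym fx) fy

module _ {n} (G : Graph n) where

  adj-sym : ∀ {a b} → adj G a b ≡ true → adj G b a ≡ true
  adj-sym {a} {b} e = trans (Graph.sym G b a) e

  adj⇒≢ : ∀ {a b} → adj G a b ≡ true → a ≢ b
  adj⇒≢ {a} e refl with () ← trans (sym e) (Graph.irrefl G a)

  adj⇒∈-neighbours : ∀ {v w} → adj G v w ≡ true → w ∈ filter (λ x → T? (adj G v x)) (allFin n)
  adj⇒∈-neighbours {v} {w} e = ∈-filter⁺ (λ x → T? (adj G v x)) (∈-allFin w) (Equivalence.from T-≡ e)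

  degree≡2⇒unique-other-neighbour : ∀ {v a b c} → degree G v ≡ 2 →
    adj G v a ≡ true → adj G v b ≡ true → adj G v c ≡ true → a ≢ b → a ≢ c → b ≡ c
  degree≡2⇒unique-other-neighbour {b = b} {c} deg va vb vc a≢b a≢c with b ≟ᶠ c
  ... | yes b≡c = b≡c
  ... | no b≢c with s≤s (s≤s ()) ← subst (3 ≤_) deg (3≤length (adj⇒∈-neighbours va)
                                       (adj⇒∈-neighbours vb) (adj⇒∈-neighbours vc) a≢b a≢c b≢c)

  neighbour? : ∀ w {P : Fin n → Set} → Decidable P → Dec (∃ λ y → adj G w y ≡ true × P y)
  neighbour? w P? = any? (λ y → (adj G w y ≟ᵇ true) ×-dec P? y)

Colour : ℕ → Set
Colour k = Fin 2 ⊎ Fin k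

IsOne : ∀ {k} → Colour k → Set
IsOne z = ∃ λ i → z ≡ inj₁ i

one≢two : ∀ {k} {z : Colour k} {j} → IsOne z → z ≢ inj₂ j
one≢two (_ , refl) ()

avoiding : ∀ {k} → Colour k → Colour k
avoiding (inj₁ fzero) = inj₁ (fsuc fzero)
avoiding _            = inj₁ fzero

avoiding-one : ∀ {k} (z : Colour k) → IsOne (avoiding z)
avoiding-one (inj₁ fzero)        = _ , refl
avoiding-one (inj₁ (fsuc fzero)) = _ , refl
avoiding-one (inj₂ _)            = _ , refl

avoiding-≢ : ∀ {k} (z : Colour k) → avoiding z ≢ z
avoiding-≢ (inj₁ fzero)        ()
avoiding-≢ (inj₁ (fsuc fzero)) ()
avoiding-≢ (inj₂ _)            ()

tieBreak : ∀ {n k} → Fin n → Fin n → Colour k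
tieBreak w x with w <? x
... | yes _ = inj₁ fzero
... | no _  = inj₁ (fsuc fzero)

tieBreak-one : ∀ {n k} (w x : Fin n) → IsOne {k} (tieBreak w x)
tieBreak-one w x with w <? x
... | yes _ = _ , refl
... | no _  = _ , refl

tieBreak-antisym : ∀ {n k} {w x : Fin n} → w ≢ x → tieBreak {k = k} w x ≢ tieBreak x w
tieBreak-antisym {w = w} {x} w≢x with w <? x | x <? w
... | yes w<x | yes x<w = contradiction x<w (<-asym w<x)
... | yes _   | no _    = λ ()
... | no _    | yes _   = λ ()
... | no w≮x  | no x≮w with ≤-total w x
...   | inj₁ w≤x = contradiction (≤∧≢⇒< w≤x w≢x) w≮x
...   | inj₂ x≤w = contradiction (≤∧≢⇒< x≤w (≢-sym w≢x)) x≮w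

record InducedPacking {n ℓ k} (G : Graph n) (S : Fin n → Set) (c : Fin n → Fin ℓ ⊎ Fin k) : Set where
  field
    adjacent-differ : ∀ {p q} → S p → S q → adj G p q ≡ true → c p ≢ c q
    no-common-neighbour : ∀ {p q w j} → S p → S q → S w → p ≢ q →
      adj G p w ≡ true → adj G w q ≡ true → c p ≡ inj₂ j → c q ≡ inj₂ j → ⊥
open InducedPacking

whole-packing : ∀ {n ℓ k} {G : Graph n} {c : Fin n → Fin ℓ ⊎ Fin k} →
  InducedPacking G U c → PackingColoring ℓ k (whole G)
whole-packing {G = G} {c} ok =
  c , (λ p q _ _ _ _ cp cq → non-adjacent (trans cp (sym cq)))
    , (λ p q _ _ p≢q _ cp cq → non-adjacent (trans cp (sym cq))
                             , λ w (pw , wq) → no-common-neighbour ok tt tt tt p≢q pw wq cp cq)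
  where
  non-adjacent : ∀ {p q} → c p ≡ c q → adj G p q ≡ false
  non-adjacent {p} {q} same with adj G p q in e
  ... | true  = contradiction same (adjacent-differ ok tt tt e)
  ... | false = refl

module _ {n} (G : Graph n) (u : Fin n) where

  survives : Fin n → Bool
  survives a = not (does (a ≟ᶠ u))

  deleteVertex : Subgraph G
  deleteVertex = record
    { keep      = survives
    ; edge      = λ a b → (survives a ∧ survives b) ∧ adj G a b
    ; edge-sym  = λ a b → cong₂ _∧_ (∧-comm (survives a) (survives b)) (Graph.sym G a b)
    ; edge⊆     = λ a b → ∧-conicalʳ _ _
    ; edge-keep = λ a b e → ∧-conicalˡ _ _ (∧-conicalˡ _ _ e)
    }

  deleteVertex-proper : Proper deleteVertex
  deleteVertex-proper = inj₁ (u , cong not (dec-true (u ≟ᶠ u) refl))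

  survives-≢ : ∀ {a} → a ≢ u → survives a ≡ true
  survives-≢ {a} a≢u = cong not (dec-false (a ≟ᶠ u) a≢u)

  deleteVertex-edge : ∀ {a b} → a ≢ u → b ≢ u → edge deleteVertex a b ≡ adj G a b
  deleteVertex-edge a≢u b≢u rewrite survives-≢ a≢u | survives-≢ b≢u = refl

  deleteVertex-packing : ∀ {ℓ k} → PackingColoring ℓ k deleteVertex →
    Σ (Fin n → Fin ℓ ⊎ Fin k) (InducedPacking G (_≢ u))
  deleteVertex-packing (c , indep₁ , indep₂) = c , record
    { adjacent-differ     = adjacent-differ′
    ; no-common-neighbour = λ {p} {q} {w} p≢u q≢u w≢u p≢q pw wq cp cq →
        proj₂ (indep₂ p q (survives-≢ p≢u) (survives-≢ q≢u) p≢q _ cp cq) w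
              (trans (deleteVertex-edge p≢u w≢u) pw , trans (deleteVertex-edge w≢u q≢u) wq)
    }
    where
    edge-kept : ∀ {p q} → p ≢ u → q ≢ u → adj G p q ≡ true → edge deleteVertex p q ≢ false
    edge-kept p≢u q≢u pq e with () ← trans (sym pq) (trans (sym (deleteVertex-edge p≢u q≢u)) e)

    adjacent-differ′ : ∀ {p q} → p ≢ u → q ≢ u → adj G p q ≡ true → c p ≢ c q
    adjacent-differ′ {p} {q} p≢u q≢u pq same with c p in cp
    ... | inj₁ i = edge-kept p≢u q≢u pq
                     (indep₁ p q (survives-≢ p≢u) (survives-≢ q≢u) (adj⇒≢ G pq) i cp (sym same))
    ... | inj₂ j = edge-kept p≢u q≢u pq
                     (proj₁ (indep₂ p q (survives-≢ p≢u) (survives-≢ q≢u) (adj⇒≢ G pq) j cp (sym same)))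

module Recolouring {n k} (G : Graph n) (u : Fin n)
  (threads : ∀ v → adj G u v ≡ true →
               degree G v ≡ 2 × (∀ w → adj G v w ≡ true → w ≢ u → degree G w ≡ 2))
  (c : Fin n → Colour (suc k)) (c-ok : InducedPacking G (_≢ u) c)
  where

  X : Colour (suc k)
  X = inj₂ fzero

  _≟ᶜ_ : (y z : Colour (suc k)) → Dec (y ≡ z)
  _≟ᶜ_ = ≡-dec _≟ᶠ_ _≟ᶠ_

  NearU : Fin n → Set
  NearU w = ∃ λ v → adj G u v ≡ true × adj G v w ≡ true

  nearU? : Decidable NearU
  nearU? w = any? (λ v → (adj G u v ≟ᵇ true) ×-dec (adj G v w ≟ᵇ true))

  -- the new colour of a vertex w ∉ N[u] that c coloured X
  farColour : Fin n → Colour (suc k)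
  farColour w with nearU? w
  ... | no _ = X
  ... | yes _ with neighbour? G w (λ y → adj G u y ≟ᵇ false)
  ...   | yes (y , _) = avoiding (c y)
  ...   | no _        = inj₁ fzero

  offColour : Fin n → Colour (suc k)
  offColour w with c w
  ... | inj₂ fzero = farColour w
  ... | z          = z

  neighbourColourVia : Fin n → Fin n → Colour (suc k)
  neighbourColourVia v x with adj G u x
  ... | true  = tieBreak v x
  ... | false = avoiding (offColour x)

  neighbourColour : Fin n → Colour (suc k)
  neighbourColour v with neighbour? G v (λ x → ¬? (x ≟ᶠ u))
  ... | yes (x , _) = neighbourColourVia v x
  ... | no _        = inj₁ fzero

  recoloured : Fin n → Colour (suc k)
  recoloured w with w ≟ᶠ u
  ... | yes _ = X
  ... | no _ with adj G u w
  ...   | true  = neighbourColour w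
  ...   | false = offColour w

  recoloured-u : recoloured u ≡ X
  recoloured-u with u ≟ᶠ u
  ... | yes _   = refl
  ... | no u≢u = contradiction refl u≢u

  recoloured-neighbour : ∀ {w} → adj G u w ≡ true → recoloured w ≡ neighbourColour w
  recoloured-neighbour {w} uw with w ≟ᶠ u
  ... | yes refl = contradiction refl (adj⇒≢ G uw)
  ... | no _ rewrite uw = refl

  recoloured-off : ∀ {w} → w ≢ u → adj G u w ≡ false → recoloured w ≡ offColour w
  recoloured-off {w} w≢u uw with w ≟ᶠ u
  ... | yes w≡u = contradiction w≡u w≢u
  ... | no _ rewrite uw = refl

  farColour-near : ∀ {w} → NearU w → IsOne (farColour w)
  farColour-near {w} near with nearU? w
  ... | no far = contradiction near far
  ... | yes _ with neighbour? G w (λ y → adj G u y ≟ᵇ false)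
  ...   | yes (y , _) = avoiding-one (c y)
  ...   | no _        = _ , refl

  farColour-far : ∀ {w} → ¬ NearU w → farColour w ≡ X
  farColour-far {w} far with nearU? w
  ... | yes near = contradiction near far
  ... | no _     = refl

  farColour-X-or-one : ∀ w → farColour w ≡ X ⊎ IsOne (farColour w)
  farColour-X-or-one w = case nearU? w of λ where
    (yes near) → inj₂ (farColour-near near)
    (no far)   → inj₁ (farColour-far far)

  farColour-avoids : ∀ {v w q} → adj G u v ≡ true → adj G v w ≡ true → w ≢ u →
    adj G w q ≡ true → adj G u q ≡ false → farColour w ≡ avoiding (c q)
  farColour-avoids {v} {w} {q} uv vw w≢u wq uq with nearU? w
  ... | no far = contradiction (v , uv , vw) far
  ... | yes _ with neighbour? G w (λ y → adj G u y ≟ᵇ false)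
  ...   | no none = contradiction (q , wq , uq) none
  ...   | yes (y , wy , uy) =
    cong (avoiding ∘ c) (degree≡2⇒unique-other-neighbour G (proj₂ (threads v uv) w vw w≢u)
                           (adj-sym G vw) wy wq (separates (adj G u) uv uy) (separates (adj G u) uv uq))

  offColour-keep : ∀ {w} → c w ≢ X → offColour w ≡ c w
  offColour-keep {w} c≢X with c w
  ... | inj₁ _        = refl
  ... | inj₂ fzero    = contradiction refl c≢X
  ... | inj₂ (fsuc _) = refl

  offColour-X : ∀ {w} → c w ≡ X → offColour w ≡ farColour w
  offColour-X cX rewrite cX = refl

  offColour-kept-or-one : ∀ w → offColour w ≡ c w ⊎ IsOne (offColour w)
  offColour-kept-or-one w with c w
  ... | inj₁ _        = inj₁ refl
  ... | inj₂ fzero    = farColour-X-or-one w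
  ... | inj₂ (fsuc _) = inj₁ refl

  offColour-two : ∀ {w j} → offColour w ≡ inj₂ j → c w ≡ inj₂ j
  offColour-two {w} e with offColour-kept-or-one w
  ... | inj₁ kept = trans (sym kept) e
  ... | inj₂ one  = contradiction e (one≢two one)

  neighbourColourVia-one : ∀ v x → IsOne (neighbourColourVia v x)
  neighbourColourVia-one v x with adj G u x
  ... | true  = tieBreak-one v x
  ... | false = avoiding-one (offColour x)

  neighbourColour-one : ∀ v → IsOne (neighbourColour v)
  neighbourColour-one v with neighbour? G v (λ x → ¬? (x ≟ᶠ u))
  ... | yes (x , _) = neighbourColourVia-one v x
  ... | no _        = _ , refl

  neighbourColour-via : ∀ {v q} → adj G u v ≡ true → adj G v q ≡ true → q ≢ u →
    neighbourColour v ≡ neighbourColourVia v q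
  neighbourColour-via {v} {q} uv vq q≢u with neighbour? G v (λ x → ¬? (x ≟ᶠ u))
  ... | no none = contradiction (q , vq , q≢u) none
  ... | yes (x , vx , x≢u) =
    cong (neighbourColourVia v) (degree≡2⇒unique-other-neighbour G (proj₁ (threads v uv))
                          (adj-sym G uv) vx vq (≢-sym x≢u) (≢-sym q≢u))

  recoloured-neighbour-one : ∀ {w} → adj G u w ≡ true → IsOne (recoloured w)
  recoloured-neighbour-one {w} uw = subst IsOne (sym (recoloured-neighbour uw)) (neighbourColour-one w)

  neighbour-differs : ∀ {p q} → adj G u p ≡ true → adj G p q ≡ true → recoloured p ≢ recoloured q
  neighbour-differs {p} {q} up pq rewrite recoloured-neighbour up with q ≟ᶠ u
  ... | yes refl = one≢two (neighbourColour-one p)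
  ... | no q≢u rewrite neighbourColour-via up pq q≢u with adj G u q in uq
  ...   | true rewrite neighbourColour-via uq (adj-sym G pq) (≢-sym (adj⇒≢ G up)) | up =
    tieBreak-antisym (adj⇒≢ G pq)
  ...   | false = avoiding-≢ (offColour q)

  farColour-differs : ∀ {w q} → w ≢ u → adj G u q ≡ false → adj G w q ≡ true → c q ≢ X →
    farColour w ≢ c q
  farColour-differs {w} {q} w≢u uq wq c≢X = case nearU? w of λ where
    (yes (v , uv , vw)) → subst (_≢ c q) (sym (farColour-avoids uv vw w≢u wq uq)) (avoiding-≢ (c q))
    (no far)            → subst (_≢ c q) (sym (farColour-far far)) (≢-sym c≢X)

  offColour-differs : ∀ {p q} → p ≢ u → q ≢ u → adj G u p ≡ false → adj G u q ≡ false →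
    adj G p q ≡ true → offColour p ≢ offColour q
  offColour-differs {p} {q} p≢u q≢u up uq pq with c p ≟ᶜ X | c q ≟ᶜ X
  ... | yes pX | yes qX = contradiction (trans pX (sym qX)) (adjacent-differ c-ok p≢u q≢u pq)
  ... | yes pX | no q≢X rewrite offColour-X pX | offColour-keep q≢X =
    farColour-differs p≢u uq pq q≢X
  ... | no p≢X | yes qX rewrite offColour-keep p≢X | offColour-X qX =
    ≢-sym (farColour-differs q≢u up (adj-sym G pq) p≢X)
  ... | no p≢X | no q≢X rewrite offColour-keep p≢X | offColour-keep q≢X =
    adjacent-differ c-ok p≢u q≢u pq

  recoloured-adjacent-differ : ∀ {p q} → adj G p q ≡ true → recoloured p ≢ recoloured q
  recoloured-adjacent-differ {p} {q} pq with adj G u p in up | adj G u q in uq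
  ... | true  | _    = neighbour-differs up pq
  ... | false | true = ≢-sym (neighbour-differs uq (adj-sym G pq))
  ... | false | false = λ same → offColour-differs p≢u q≢u up uq pq
    (trans (sym (recoloured-off p≢u up)) (trans same (recoloured-off q≢u uq)))
    where
    p≢u : p ≢ u
    p≢u refl = separates (adj G u) pq uq refl
    q≢u : q ≢ u
    q≢u refl = separates (adj G u) (adj-sym G pq) up refl

  recoloured-two-off : ∀ {p j} → p ≢ u → recoloured p ≡ inj₂ j → c p ≡ inj₂ j
  recoloured-two-off {p} p≢u e with adj G u p in up
  ... | true  = contradiction e (one≢two (recoloured-neighbour-one up))
  ... | false = offColour-two (trans (sym (recoloured-off p≢u up)) e)

  recoloured-two : ∀ {p j} → recoloured p ≡ inj₂ j → p ≡ u ⊎ (p ≢ u × c p ≡ inj₂ j)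
  recoloured-two {p} e = case p ≟ᶠ u of λ where
    (yes p≡u) → inj₁ p≡u
    (no p≢u)  → inj₂ (p≢u , recoloured-two-off p≢u e)

  X-far-from-u : ∀ {q w} → q ≢ u → recoloured q ≡ X → adj G u w ≡ true → adj G w q ≡ true → ⊥
  X-far-from-u {q} {w} q≢u qX uw wq with adj G u q in uq
  ... | true  = one≢two (recoloured-neighbour-one uq) qX
  ... | false = one≢two (farColour-near (w , uw , wq)) (trans (sym (offColour-X cX)) offX)
    where
    offX : offColour q ≡ X
    offX = trans (sym (recoloured-off q≢u uq)) qX
    cX : c q ≡ X
    cX = offColour-two offX

  recoloured-no-common-neighbour : ∀ {p q w j} → p ≢ q → adj G p w ≡ true → adj G w q ≡ true →
    recoloured p ≡ inj₂ j → recoloured q ≡ inj₂ j → ⊥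
  recoloured-no-common-neighbour {p} {q} {w} p≢q pw wq pj qj with recoloured-two {p} pj | recoloured-two {q} qj
  ... | inj₁ refl | _ = X-far-from-u (≢-sym p≢q) (trans qj (trans (sym pj) recoloured-u)) pw wq
  ... | inj₂ _ | inj₁ refl =
    X-far-from-u p≢q (trans pj (trans (sym qj) recoloured-u)) (adj-sym G wq) (adj-sym G pw)
  ... | inj₂ (p≢u , cp) | inj₂ (q≢u , cq) = no-common-neighbour c-ok p≢u q≢u w≢u p≢q pw wq cp cq
    where
    w≢u : w ≢ u
    w≢u refl = one≢two (recoloured-neighbour-one (adj-sym G pw)) pj

  recoloured-packing : InducedPacking G U recoloured
  recoloured-packing = record
    { adjacent-differ     = λ _ _ → recoloured-adjacent-differ
    ; no-common-neighbour = λ _ _ _ → recoloured-no-common-neighbour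
    }

lemma3p5 : (k : ℕ) → 1 ≤ k → ∀ {n} (G : Graph n) → Critical12 k G →
    ∀ (u : Fin n) → ¬ AdjOnlyTo2Threads G u
lemma3p5 (suc k) _ G (uncolourable , critical) u (_ , threads)
  with c , c-ok ← deleteVertex-packing G u (critical (deleteVertex G u) (deleteVertex-proper G u))
  = uncolourable (whole-packing (Recolouring.recoloured-packing G u threads c c-ok))
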